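{- Let $(T,Z,Y,\tau^{ -\times Z},\tau^T,\alpha,q)$ be a product situation in a bi-CCC $\mathbb{C}$. Define: (i) $\beta\colon T(-\times Z)\Rightarrow T(-\times Y)^Y$ by $\beta_X:=u^{T,Y}_{X\times Y}\circ T(\alpha_X)$; (ii) $\tau^{T(-\times Z)}\colon T(T(\Omega^{ -\times Z})\times Z)\to T(\Omega^{ -\times Z})$ by $\tau^{T(-\times Z)}:=\mu^T_{\Omega^{ -\times Z}}\circ T^2(\tau^{ -\times Z})\circ T(\mathrm{st}'^T_{\Omega^{ -\times Z},Z})$; (iii) $\tau^{T(-\times Y)^Y}\colon T((\Omega^T)^Y\times Y)^Y\to(\Omega^T)^Y$ by $\tau^{T(-\times Y)^Y}:=(\tau^T)^Y\circ T(\mathrm{ev}_{\Omega^T,Y})^Y$; (iv) $q^T\colon T(\Omega^{ -\times Z})\to(\Omega^T)^Y$ by $q^T:=(\tau^T)^Y\circ u^{T,Y}_{\Omega^T}\circ T(q)$. Then $\beta$ is a strong monad morphism from $T(-\times Z)$ to $T(-\times Y)^Y$, $\tau^{T(-\times Z)}$ and $\tau^{T(-\times Y)^Y}$ are Eilenberg–Moore algebras for $T(-\times Z)$ and $T(-\times Y)^Y$ respectively, and $q^T$ is an inference query for $\beta$, $\tau^{T(-\times Z)}$ and $\tau^{T(-\times Y)^Y}$, i.e. $q^T\circ\tau^{T(-\times Z)}=\tau^{T(-\times Y)^Y}\circ T(q^T\times Y)^Y\circ\beta_{T(\Omega^{ -\times Z})}$.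
   Context: $\mathbb{C}$ is a bicartesian closed category; $\mathrm{ev}_{X,Y}\colon X^Y\times Y\to X$ is evaluation and $(\cdot)^\dagger$ is transposition along $(-\times Y)\dashv(-)^Y$. A strong monad $(T,\eta^T,\mu^T,\mathrm{st}^T)$ has left strength $\mathrm{st}^T_{X,W}\colon X\times TW\to T(X\times W)$ and right strength $\mathrm{st}'^T_{W,X}\colon TW\times X\to T(W\times X)$. For a strong monad $T$ and object $Y$, $u^{T,Y}_X\colon T(X^Y)\to T(X)^Y$ is $u^{T,Y}_X:=(T(\mathrm{ev}_{X,Y})\circ\mathrm{st}'^T_{X^Y,Y})^\dagger$. Strong monad $T(-\times Y)^Y$: unit $\eta_X=(\eta^T_{X\times Y})^\dagger$, multiplication $\mu_X=(\mu^T_{X\times Y}\circ T(\mathrm{ev}_{T(X\times Y),Y}))^Y$, left strength $\mathrm{st}_{X,W}=(\mathrm{st}^T_{X,W\times Y}\circ(X\times\mathrm{ev}_{T(W\times Y),Y}))^\dagger$ (up to associativity). The state monad $(-\times Y)^Y$ is the case $T=\mathrm{Id}$. For a monoid object $Z$, $-\times Z$ is the writer (action) monad with the evident strength; $T(-\times Z)$ is the composite strong monad induced by the right strength of $T$ (as a distributive law). A strong monad morphism $\alpha\colon T\Rightarrow U$ is a natural transformation with $\alpha\circ\eta^T=\eta^U$, $\alpha\circ\mu^T=\mu^U\circ U(\alpha)\circ\alpha_T$, $\alpha\circ\mathrm{st}^T=\mathrm{st}^U\circ(\mathrm{id}\times\alpha)$. For strong monads $T,U$, a strong monad morphism $\alpha\colon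 T\Rightarrow U$ and Eilenberg–Moore algebras $\tau^T\colon T\Omega^T\to\Omega^T$, $\tau^U\colon U\Omega^U\to\Omega^U$, an inference query is a morphism $q\colon\Omega^T\to\Omega^U$ with $q\circ\tau^T=\tau^U\circ U(q)\circ\alpha_{\Omega^T}$. A product situation is a tuple $(T,Z,Y,\tau^{ -\times Z},\tau^T,\alpha,q)$ where: $T$ is a strong monad on $\mathbb{C}$; $Z$ is a monoid object (so $-\times Z$ is a writer monad) and $Y$ is an object; $\tau^{ -\times Z}\colon\Omega^{ -\times Z}\times Z\to\Omega^{ -\times Z}$ and $\tau^T\colon T(\Omega^T)\to\Omega^T$ are Eilenberg–Moore algebras; $\alpha\colon-\times Z\Rightarrow(-\times Y)^Y$ is a strong monad morphism; and $q\colon\Omega^{ -\times Z}\to(\Omega^T)^Y$ is an inference query for the monads $-\times Z$ and $(-\times Y)^Y$, the morphism $\alpha$, the algebra $\tau^{ -\times Z}$ and the algebra $\tau^{(-\times Y)^Y}:=(\mathrm{ev}_{\Omega^T,Y})^Y\colon((\Omega^T)^Y\times Y)^Y\to(\Omega^T)^Y$. -}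

module Defs where

open import Level using (Level; _⊔_) renaming (suc to lsuc)
open import Relation.Binary.PropositionalEquality using (_≡_)
open import Data.Product using (_×_; _,_)

record BiCCC (o ℓ : Level) : Set (lsuc (o ⊔ ℓ)) where
  infixr 9 _∘_
  infixr 7 _⊗_
  infixr 6 _⊕_
  infixl 8 _^_
  field
    Obj : Set o
    Hom : Obj → Obj → Set ℓ
    id  : ∀ {A} → Hom A A
    _∘_ : ∀ {A B C} → Hom B C → Hom A B → Hom A C
    identityˡ : ∀ {A B} {f : Hom A B} → id ∘ f ≡ f
    identityʳ : ∀ {A B} {f : Hom A B} → f ∘ id ≡ f
    assoc : ∀ {A B C D} {f : Hom A B} {g : Hom B C} {h : Hom C D} →
            (h ∘ g) ∘ f ≡ h ∘ (g ∘ f)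
    ⊤ : Obj
    ! : ∀ {A} → Hom A ⊤
    !-unique : ∀ {A} (f : Hom A ⊤) → f ≡ !
    _⊗_ : Obj → Obj → Obj
    π₁ : ∀ {A B} → Hom (A ⊗ B) A
    π₂ : ∀ {A B} → Hom (A ⊗ B) B
    ⟨_,_⟩ : ∀ {A B C} → Hom C A → Hom C B → Hom C (A ⊗ B)
    π₁∘⟨⟩ : ∀ {A B C} {f : Hom C A} {g : Hom C B} → π₁ ∘ ⟨ f , g ⟩ ≡ f
    π₂∘⟨⟩ : ∀ {A B C} {f : Hom C A} {g : Hom C B} → π₂ ∘ ⟨ f , g ⟩ ≡ g
    ⟨⟩-unique : ∀ {A B C} {f : Hom C A} {g : Hom C B} {h : Hom C (A ⊗ B)} →
                π₁ ∘ h ≡ f → π₂ ∘ h ≡ g → h ≡ ⟨ f , g ⟩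
    ⊥ : Obj
    ¡ : ∀ {A} → Hom ⊥ A
    ¡-unique : ∀ {A} (f : Hom ⊥ A) → f ≡ ¡
    _⊕_ : Obj → Obj → Obj
    i₁ : ∀ {A B} → Hom A (A ⊕ B)
    i₂ : ∀ {A B} → Hom B (A ⊕ B)
    [_,_] : ∀ {A B C} → Hom A C → Hom B C → Hom (A ⊕ B) C
    []∘i₁ : ∀ {A B C} {f : Hom A C} {g : Hom B C} → [ f , g ] ∘ i₁ ≡ f
    []∘i₂ : ∀ {A B C} {f : Hom A C} {g : Hom B C} → [ f , g ] ∘ i₂ ≡ g
    []-unique : ∀ {A B C} {f : Hom A C} {g : Hom B C} {h : Hom (A ⊕ B) C} →
                h ∘ i₁ ≡ f → h ∘ i₂ ≡ g → h ≡ [ f , g ]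
    _^_ : Obj → Obj → Obj
    ev : ∀ X Y → Hom ((X ^ Y) ⊗ Y) X
    Λ : ∀ {A X Y} → Hom (A ⊗ Y) X → Hom A (X ^ Y)
    ev∘Λ : ∀ {A X Y} {f : Hom (A ⊗ Y) X} →
           ev X Y ∘ ⟨ Λ f ∘ π₁ , π₂ ⟩ ≡ f
    Λ-unique : ∀ {A X Y} {f : Hom (A ⊗ Y) X} {g : Hom A (X ^ Y)} →
               ev X Y ∘ ⟨ g ∘ π₁ , π₂ ⟩ ≡ f → g ≡ Λ f

module Ops {o ℓ : Level} (C : BiCCC o ℓ) where
  open BiCCC C

  _×₁_ : ∀ {A B A' B'} → Hom A A' → Hom B B' → Hom (A ⊗ B) (A' ⊗ B')
  f ×₁ g = ⟨ f ∘ π₁ , g ∘ π₂ ⟩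

  _^₁_ : ∀ {A B} → Hom A B → (Y : Obj) → Hom (A ^ Y) (B ^ Y)
  f ^₁ Y = Λ (f ∘ ev _ Y)

  α⇒ : ∀ {A B D} → Hom ((A ⊗ B) ⊗ D) (A ⊗ (B ⊗ D))
  α⇒ = ⟨ π₁ ∘ π₁ , ⟨ π₂ ∘ π₁ , π₂ ⟩ ⟩

  α⇐ : ∀ {A B D} → Hom (A ⊗ (B ⊗ D)) ((A ⊗ B) ⊗ D)
  α⇐ = ⟨ ⟨ π₁ , π₁ ∘ π₂ ⟩ , π₂ ∘ π₂ ⟩

  swap : ∀ {A B} → Hom (A ⊗ B) (B ⊗ A)
  swap = ⟨ π₂ , π₁ ⟩

module _ {o ℓ : Level} (C : BiCCC o ℓ) where
  open BiCCC C
  open Ops C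

  record RawStrongMonad : Set (o ⊔ ℓ) where
    field
      F₀ : Obj → Obj
      F₁ : ∀ {A B} → Hom A B → Hom (F₀ A) (F₀ B)
      η  : ∀ X → Hom X (F₀ X)
      μ  : ∀ X → Hom (F₀ (F₀ X)) (F₀ X)
      st : ∀ X W → Hom (X ⊗ F₀ W) (F₀ (X ⊗ W))

    st′ : ∀ W X → Hom (F₀ W ⊗ X) (F₀ (W ⊗ X))
    st′ W X = F₁ swap ∘ (st X W ∘ swap)

  record IsStrongMonad (T : RawStrongMonad) : Set (o ⊔ ℓ) where
    open RawStrongMonad T
    field
      F-id : ∀ {A} → F₁ (id {A}) ≡ id
      F-∘  : ∀ {A B D} {f : Hom A B} {g : Hom B D} → F₁ (g ∘ f) ≡ F₁ g ∘ F₁ f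
      η-natural : ∀ {A B} (f : Hom A B) → F₁ f ∘ η A ≡ η B ∘ f
      μ-natural : ∀ {A B} (f : Hom A B) → F₁ f ∘ μ A ≡ μ B ∘ F₁ (F₁ f)
      μ-assoc : ∀ X → μ X ∘ F₁ (μ X) ≡ μ X ∘ μ (F₀ X)
      μ-unitˡ : ∀ X → μ X ∘ η (F₀ X) ≡ id
      μ-unitʳ : ∀ X → μ X ∘ F₁ (η X) ≡ id
      st-natural : ∀ {A B A' B'} (f : Hom A A') (g : Hom B B') →
                   F₁ (f ×₁ g) ∘ st A B ≡ st A' B' ∘ (f ×₁ F₁ g)
      st-unit : ∀ X → F₁ π₂ ∘ st ⊤ X ≡ π₂
      st-assoc : ∀ A B D →
                 F₁ α⇒ ∘ st (A ⊗ B) D ≡ st A (B ⊗ D) ∘ ((id ×₁ st B D) ∘ α⇒)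
      st-η : ∀ A B → st A B ∘ (id ×₁ η B) ≡ η (A ⊗ B)
      st-μ : ∀ A B → st A B ∘ (id ×₁ μ B) ≡ μ (A ⊗ B) ∘ (F₁ (st A B) ∘ st A (F₀ B))

  record IsStrongMonadMorphism (T U : RawStrongMonad)
         (α : ∀ X → Hom (RawStrongMonad.F₀ T X) (RawStrongMonad.F₀ U X)) : Set (o ⊔ ℓ) where
    module T = RawStrongMonad T
    module U = RawStrongMonad U
    field
      natural : ∀ {A B} (f : Hom A B) → U.F₁ f ∘ α A ≡ α B ∘ T.F₁ f
      pres-η : ∀ X → α X ∘ T.η X ≡ U.η X
      pres-μ : ∀ X → α X ∘ T.μ X ≡ U.μ X ∘ (U.F₁ (α X) ∘ α (T.F₀ X))
      pres-st : ∀ X W → α (X ⊗ W) ∘ T.st X W ≡ U.st X W ∘ (id ×₁ α W)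

  record IsEMAlgebra (T : RawStrongMonad) (Ω : Obj)
         (τ : Hom (RawStrongMonad.F₀ T Ω) Ω) : Set ℓ where
    open RawStrongMonad T
    field
      unit : τ ∘ η Ω ≡ id
      mult : τ ∘ μ Ω ≡ τ ∘ F₁ τ

  IsInferenceQuery : (T U : RawStrongMonad)
    (α : ∀ X → Hom (RawStrongMonad.F₀ T X) (RawStrongMonad.F₀ U X))
    (ΩT : Obj) (τT : Hom (RawStrongMonad.F₀ T ΩT) ΩT)
    (ΩU : Obj) (τU : Hom (RawStrongMonad.F₀ U ΩU) ΩU)
    (q : Hom ΩT ΩU) → Set ℓ
  IsInferenceQuery T U α ΩT τT ΩU τU q =
    q ∘ τT ≡ τU ∘ (RawStrongMonad.F₁ U q ∘ α ΩT)

  record MonoidObject : Set (o ⊔ ℓ) where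
    field
      Z : Obj
      e : Hom ⊤ Z
      m : Hom (Z ⊗ Z) Z
      unitˡ : m ∘ ⟨ e ∘ ! , id ⟩ ≡ id
      unitʳ : m ∘ ⟨ id , e ∘ ! ⟩ ≡ id
      mult-assoc : m ∘ (m ×₁ id) ≡ m ∘ ((id ×₁ m) ∘ α⇒)

  IdMonad : RawStrongMonad
  IdMonad = record
    { F₀ = λ X → X ; F₁ = λ f → f ; η = λ X → id ; μ = λ X → id
    ; st = λ X W → id }

  Writer : MonoidObject → RawStrongMonad
  Writer M = record
    { F₀ = λ X → X ⊗ Z
    ; F₁ = λ f → f ×₁ id
    ; η  = λ X → ⟨ id , e ∘ ! ⟩
    ; μ  = λ X → (id ×₁ m) ∘ α⇒
    ; st = λ X W → α⇐ }
    where open MonoidObject M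

  -- composite T(- × Z), using the right strength of T as distributive law
  -- λ_X = st'^T_{X,Z} : T X × Z → T (X × Z)
  TWriter : RawStrongMonad → MonoidObject → RawStrongMonad
  TWriter T M = record
    { F₀ = λ X → T.F₀ (W.F₀ X)
    ; F₁ = λ f → T.F₁ (W.F₁ f)
    ; η  = λ X → T.η (W.F₀ X) ∘ W.η X
    ; μ  = λ X → T.F₁ (W.μ X) ∘ (T.μ (W.F₀ (W.F₀ X)) ∘ T.F₁ (T.st′ (W.F₀ X) (MonoidObject.Z M)))
    ; st = λ X A → T.F₁ (W.st X A) ∘ T.st X (W.F₀ A) }
    where
      module T = RawStrongMonad T
      module W = RawStrongMonad (Writer M)

  StateT : RawStrongMonad → Obj → RawStrongMonad
  StateT T Y = record
    { F₀ = λ X → T.F₀ (X ⊗ Y) ^ Y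
    ; F₁ = λ f → T.F₁ (f ×₁ id) ^₁ Y
    ; η  = λ X → Λ (T.η (X ⊗ Y))
    ; μ  = λ X → (T.μ (X ⊗ Y) ∘ T.F₁ (ev (T.F₀ (X ⊗ Y)) Y)) ^₁ Y
    ; st = λ X W → Λ (T.F₁ α⇐ ∘ (T.st X (W ⊗ Y) ∘ ((id ×₁ ev (T.F₀ (W ⊗ Y)) Y) ∘ α⇒))) }
    where module T = RawStrongMonad T

  State : Obj → RawStrongMonad
  State Y = StateT IdMonad Y

  u : (T : RawStrongMonad) (Y X : Obj) →
      Hom (RawStrongMonad.F₀ T (X ^ Y)) (RawStrongMonad.F₀ T X ^ Y)
  u T Y X = Λ (F₁ (ev X Y) ∘ st′ (X ^ Y) Y)
    where open RawStrongMonad T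

  record ProductSituation : Set (o ⊔ ℓ) where
    field
      T : RawStrongMonad
      T-strong : IsStrongMonad T
      M : MonoidObject
      Y : Obj
      Ω× : Obj
      τ× : Hom (Ω× ⊗ MonoidObject.Z M) Ω×
      τ×-alg : IsEMAlgebra (Writer M) Ω× τ×
      ΩT : Obj
      τT : Hom (RawStrongMonad.F₀ T ΩT) ΩT
      τT-alg : IsEMAlgebra T ΩT τT
      α : ∀ X → Hom (X ⊗ MonoidObject.Z M) ((X ⊗ Y) ^ Y)
      α-morphism : IsStrongMonadMorphism (Writer M) (State Y) α
      q : Hom Ω× (ΩT ^ Y)
      q-query : IsInferenceQuery (Writer M) (State Y) α
                  Ω× τ× (ΩT ^ Y) (ev ΩT Y ^₁ Y) q

  module Prop49Data (P : ProductSituation) where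
    open ProductSituation P
    module T = RawStrongMonad T
    Z : Obj
    Z = MonoidObject.Z M

    TW : RawStrongMonad
    TW = TWriter T M

    TS : RawStrongMonad
    TS = StateT T Y

    β : ∀ X → Hom (T.F₀ (X ⊗ Z)) (T.F₀ (X ⊗ Y) ^ Y)
    β X = u T Y (X ⊗ Y) ∘ T.F₁ (α X)

    τTW : Hom (T.F₀ (T.F₀ Ω× ⊗ Z)) (T.F₀ Ω×)
    τTW = T.μ Ω× ∘ (T.F₁ (T.F₁ τ×) ∘ T.F₁ (T.st′ Ω× Z))

    τTS : Hom (T.F₀ ((ΩT ^ Y) ⊗ Y) ^ Y) (ΩT ^ Y)
    τTS = (τT ^₁ Y) ∘ (T.F₁ (ev ΩT Y) ^₁ Y)

    qT : Hom (T.F₀ Ω×) (ΩT ^ Y)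
    qT = (τT ^₁ Y) ∘ (u T Y ΩT ∘ T.F₁ q)

-- Everything is checked after uncurrying along Λ. A strong monad morphism α from the writer
-- monad - × Z to the state monad (- × Y)^Y is, by naturality and strength, determined by the
-- action a : Z × Y → Y read off at ⊤: uncurried, α_X is id_X × a up to associativity. Hence the
-- uncurried α commutes with the right strength of T, which is exactly what β = u ∘ T(α) needs to
-- preserve the composite multiplications and what q^T needs to intertwine the two algebras.
-- The algebra τ^{T(-×Z)} is μ^T ∘ T(ρ) for the Z-action ρ = T(τ^{-×Z}) ∘ st′ on T Ω, and
-- τ^{T(-×Y)^Y} is the exponential of τ^T ∘ T(ev); their laws are those of τ^{-×Z} and τ^T.

module Submission where

open import Defs
open import Level using (Level)
open import Data.Product using (_×_; _,_)
open import Relation.Binary.PropositionalEquality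
open ≡-Reasoning

module _ {o ℓ : Level} (C : BiCCC o ℓ) where
  open BiCCC C
  open Ops C

  private variable
    A B D E F W A′ B′ D′ X X′ X″ V : Obj
    f f′ g g′ : Hom A B

  infixr 4 refl⟩∘⟨_ _⟩∘⟨_
  infixl 5 _⟩∘⟨refl

  refl⟩∘⟨_ : g ≡ g′ → f ∘ g ≡ f ∘ g′
  refl⟩∘⟨_ {f = f} = cong (f ∘_)

  _⟩∘⟨refl : f ≡ f′ → f ∘ g ≡ f′ ∘ g
  _⟩∘⟨refl {g = g} = cong (_∘ g)

  _⟩∘⟨_ : f ≡ f′ → g ≡ g′ → f ∘ g ≡ f′ ∘ g′
  _⟩∘⟨_ = cong₂ _∘_

  pullˡ : {a : Hom B D} {b : Hom A B} {c : Hom A D} {f : Hom E A} →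
          a ∘ b ≡ c → a ∘ (b ∘ f) ≡ c ∘ f
  pullˡ p = trans (sym assoc) (p ⟩∘⟨refl)

  pullʳ : {a : Hom B D} {b : Hom A B} {c : Hom A D} {f : Hom D E} →
          a ∘ b ≡ c → (f ∘ a) ∘ b ≡ f ∘ c
  pullʳ p = trans assoc (refl⟩∘⟨ p)

  extendʳ : {a : Hom B D} {b : Hom A B} {c : Hom B′ D} {d : Hom A B′} {f : Hom E A} →
            a ∘ b ≡ c ∘ d → a ∘ (b ∘ f) ≡ c ∘ (d ∘ f)
  extendʳ p = trans (sym assoc) (trans (p ⟩∘⟨refl) assoc)

  cancelˡ : {a : Hom B A} {b : Hom A B} {f : Hom E A} → a ∘ b ≡ id → a ∘ (b ∘ f) ≡ f
  cancelˡ p = trans (pullˡ p) identityˡ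

  ⟨⟩∘ : {f : Hom B D} {g : Hom B E} {h : Hom A B} → ⟨ f , g ⟩ ∘ h ≡ ⟨ f ∘ h , g ∘ h ⟩
  ⟨⟩∘ = ⟨⟩-unique (pullˡ π₁∘⟨⟩) (pullˡ π₂∘⟨⟩)

  ⟨⟩-ext : {f g : Hom A (B ⊗ D)} → π₁ ∘ f ≡ π₁ ∘ g → π₂ ∘ f ≡ π₂ ∘ g → f ≡ g
  ⟨⟩-ext p q = trans (⟨⟩-unique p q) (sym (⟨⟩-unique refl refl))

  ⟨⟩-η : ⟨ π₁ , π₂ ⟩ ≡ id {A ⊗ B}
  ⟨⟩-η = sym (⟨⟩-unique identityʳ identityʳ)

  ⟨⟩-cong₂ : {f f′ : Hom A B} {g g′ : Hom A D} → f ≡ f′ → g ≡ g′ → ⟨ f , g ⟩ ≡ ⟨ f′ , g′ ⟩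
  ⟨⟩-cong₂ = cong₂ ⟨_,_⟩

  ×₁∘⟨⟩ : {f : Hom A B} {g : Hom D E} {h : Hom F A} {k : Hom F D} →
          (f ×₁ g) ∘ ⟨ h , k ⟩ ≡ ⟨ f ∘ h , g ∘ k ⟩
  ×₁∘⟨⟩ = trans ⟨⟩∘ (⟨⟩-cong₂ (pullʳ π₁∘⟨⟩) (pullʳ π₂∘⟨⟩))

  ×₁∘×₁ : {f : Hom A B} {g : Hom D E} {h : Hom A′ A} {k : Hom D′ D} →
          (f ×₁ g) ∘ (h ×₁ k) ≡ (f ∘ h) ×₁ (g ∘ k)
  ×₁∘×₁ = trans ×₁∘⟨⟩ (⟨⟩-cong₂ (sym assoc) (sym assoc))

  id×₁id : id {A} ×₁ id {B} ≡ id
  id×₁id = trans (⟨⟩-cong₂ identityˡ identityˡ) ⟨⟩-η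

  id×₁∘id×₁ : {f : Hom B D} {g : Hom A B} → (id {E} ×₁ f) ∘ (id ×₁ g) ≡ id ×₁ (f ∘ g)
  id×₁∘id×₁ = trans ×₁∘×₁ (cong (_×₁ _) identityˡ)

  ×₁id∘×₁id : {f : Hom B D} {g : Hom A B} → (f ×₁ id {E}) ∘ (g ×₁ id) ≡ (f ∘ g) ×₁ id
  ×₁id∘×₁id = trans ×₁∘×₁ (cong (_ ×₁_) identityˡ)

  Λ⁻¹ : Hom A (X ^ V) → Hom (A ⊗ V) X
  Λ⁻¹ {X = X} {V = V} g = ev X V ∘ (g ×₁ id)

  Λ⁻¹-Λ : {f : Hom (A ⊗ V) X} → Λ⁻¹ (Λ f) ≡ f
  Λ⁻¹-Λ = trans (refl⟩∘⟨ ⟨⟩-cong₂ refl identityˡ) ev∘Λ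

  Λ-Λ⁻¹ : {g : Hom A (X ^ V)} → Λ (Λ⁻¹ g) ≡ g
  Λ-Λ⁻¹ = sym (Λ-unique (refl⟩∘⟨ ⟨⟩-cong₂ refl (sym identityˡ)))

  Λ⁻¹-injective : {g h : Hom A (X ^ V)} → Λ⁻¹ g ≡ Λ⁻¹ h → g ≡ h
  Λ⁻¹-injective p = trans (sym Λ-Λ⁻¹) (trans (cong Λ p) Λ-Λ⁻¹)

  Λ⁻¹-∘ : {g : Hom B (X ^ V)} {h : Hom A B} → Λ⁻¹ (g ∘ h) ≡ Λ⁻¹ g ∘ (h ×₁ id)
  Λ⁻¹-∘ = trans (refl⟩∘⟨ sym ×₁id∘×₁id) (sym assoc)

  Λ⁻¹-^₁ : {f : Hom X X′} {g : Hom A (X ^ V)} → Λ⁻¹ ((f ^₁ V) ∘ g) ≡ f ∘ Λ⁻¹ g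
  Λ⁻¹-^₁ = trans Λ⁻¹-∘ (trans (Λ⁻¹-Λ ⟩∘⟨refl) assoc)

  ^₁∘^₁ : {f : Hom X X′} {g : Hom X′ X″} → (g ^₁ V) ∘ (f ^₁ V) ≡ (g ∘ f) ^₁ V
  ^₁∘^₁ = Λ⁻¹-injective (trans Λ⁻¹-^₁ (trans (refl⟩∘⟨ Λ⁻¹-Λ) (trans (sym assoc) (sym Λ⁻¹-Λ))))

  swap∘⟨⟩ : {f : Hom A B} {g : Hom A D} → swap ∘ ⟨ f , g ⟩ ≡ ⟨ g , f ⟩
  swap∘⟨⟩ = trans ⟨⟩∘ (⟨⟩-cong₂ π₂∘⟨⟩ π₁∘⟨⟩)

  α⇒∘⟨⟨⟩⟩ : {f : Hom A B} {g : Hom A D} {h : Hom A E} → α⇒ ∘ ⟨ ⟨ f , g ⟩ , h ⟩ ≡ ⟨ f , ⟨ g , h ⟩ ⟩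
  α⇒∘⟨⟨⟩⟩ = trans ⟨⟩∘ (⟨⟩-cong₂ (trans (pullʳ π₁∘⟨⟩) π₁∘⟨⟩)
                                (trans ⟨⟩∘ (⟨⟩-cong₂ (trans (pullʳ π₁∘⟨⟩) π₂∘⟨⟩) π₂∘⟨⟩)))

  α⇐∘⟨⟩ : {f : Hom A B} {g : Hom A (D ⊗ E)} → α⇐ ∘ ⟨ f , g ⟩ ≡ ⟨ ⟨ f , π₁ ∘ g ⟩ , π₂ ∘ g ⟩
  α⇐∘⟨⟩ = trans ⟨⟩∘ (⟨⟩-cong₂ (trans ⟨⟩∘ (⟨⟩-cong₂ π₁∘⟨⟩ (pullʳ π₂∘⟨⟩))) (pullʳ π₂∘⟨⟩))

  α⇐∘⟨⟨⟩⟩ : {f : Hom A B} {g : Hom A D} {h : Hom A E} → α⇐ ∘ ⟨ f , ⟨ g , h ⟩ ⟩ ≡ ⟨ ⟨ f , g ⟩ , h ⟩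
  α⇐∘⟨⟨⟩⟩ = trans α⇐∘⟨⟩ (⟨⟩-cong₂ (⟨⟩-cong₂ refl π₁∘⟨⟩) π₂∘⟨⟩)

  α⇒∘α⇐ : α⇒ ∘ α⇐ ≡ id {A ⊗ (B ⊗ D)}
  α⇒∘α⇐ = trans α⇒∘⟨⟨⟩⟩ (trans (⟨⟩-cong₂ refl (trans (sym ⟨⟩∘) (⟨⟩-η ⟩∘⟨refl))) (trans (⟨⟩-cong₂ refl identityˡ) ⟨⟩-η))

  α⇐∘α⇒ : α⇐ ∘ α⇒ ≡ id {(A ⊗ B) ⊗ D}
  α⇐∘α⇒ = trans α⇐∘⟨⟨⟩⟩ (trans (⟨⟩-cong₂ (trans (sym ⟨⟩∘) (⟨⟩-η ⟩∘⟨refl)) refl) (trans (⟨⟩-cong₂ identityˡ refl) ⟨⟩-η))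

  swap∘swap : swap ∘ swap ≡ id {A ⊗ B}
  swap∘swap = trans swap∘⟨⟩ ⟨⟩-η

  swap∘×₁ : {f : Hom A B} {g : Hom D E} → swap ∘ (f ×₁ g) ≡ (g ×₁ f) ∘ swap
  swap∘×₁ = trans swap∘⟨⟩ (sym ×₁∘⟨⟩)

  α⇒∘×₁ : {f : Hom A A′} {g : Hom B B′} {h : Hom D D′} →
          α⇒ ∘ ((f ×₁ g) ×₁ h) ≡ (f ×₁ (g ×₁ h)) ∘ α⇒
  α⇒∘×₁ {f = f} {g} {h} = begin
    α⇒ ∘ ((f ×₁ g) ×₁ h)                                   ≡⟨ refl⟩∘⟨ ⟨⟩-cong₂ ⟨⟩∘ refl ⟩
    α⇒ ∘ ⟨ ⟨ (f ∘ π₁) ∘ π₁ , (g ∘ π₂) ∘ π₁ ⟩ , h ∘ π₂ ⟩   ≡⟨ α⇒∘⟨⟨⟩⟩ ⟩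
    ⟨ (f ∘ π₁) ∘ π₁ , ⟨ (g ∘ π₂) ∘ π₁ , h ∘ π₂ ⟩ ⟩         ≡⟨ ⟨⟩-cong₂ assoc (trans (⟨⟩-cong₂ assoc refl) (sym ×₁∘⟨⟩)) ⟩
    ⟨ f ∘ (π₁ ∘ π₁) , (g ×₁ h) ∘ ⟨ π₂ ∘ π₁ , π₂ ⟩ ⟩         ≡⟨ sym ×₁∘⟨⟩ ⟩
    (f ×₁ (g ×₁ h)) ∘ α⇒                                   ∎

  module RightStrength (T : RawStrongMonad C) (isT : IsStrongMonad C T) where
    open RawStrongMonad T
    open IsStrongMonad isT

    F-merge : {f : Hom A B} {g : Hom B D} → F₁ g ∘ F₁ f ≡ F₁ (g ∘ f)
    F-merge = sym F-∘

    F-mergeˡ : {f : Hom A B} {g : Hom B D} {h : Hom E (F₀ A)} → F₁ g ∘ (F₁ f ∘ h) ≡ F₁ (g ∘ f) ∘ h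
    F-mergeˡ = pullˡ F-merge

    st-natural₁ : {f : Hom A D} → F₁ (f ×₁ id {B}) ∘ st A B ≡ st D B ∘ (f ×₁ id)
    st-natural₁ = trans (st-natural _ id) (refl⟩∘⟨ cong (_ ×₁_) F-id)

    st-natural₂ : {g : Hom B D} → F₁ (id {A} ×₁ g) ∘ st A B ≡ st A D ∘ (id ×₁ F₁ g)
    st-natural₂ = st-natural id _

    st∘id×₁st : st B (A ⊗ W) ∘ (id ×₁ st A W) ≡ F₁ α⇒ ∘ (st (B ⊗ A) W ∘ α⇐)
    st∘id×₁st = begin
      st _ _ ∘ (id ×₁ st _ _)                  ≡⟨ sym (trans (refl⟩∘⟨ α⇒∘α⇐) identityʳ) ⟩
      (st _ _ ∘ (id ×₁ st _ _)) ∘ (α⇒ ∘ α⇐)    ≡⟨ pullˡ (trans assoc (sym (st-assoc _ _ _))) ⟩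
      (F₁ α⇒ ∘ st _ _) ∘ α⇐                    ≡⟨ assoc ⟩
      F₁ α⇒ ∘ (st _ _ ∘ α⇐)                    ∎

    st′-natural : {f : Hom W A} {g : Hom X B} → F₁ (f ×₁ g) ∘ st′ W X ≡ st′ A B ∘ (F₁ f ×₁ g)
    st′-natural {f = f} {g = g} = begin
      F₁ (f ×₁ g) ∘ (F₁ swap ∘ (st _ _ ∘ swap))  ≡⟨ F-mergeˡ ⟩
      F₁ ((f ×₁ g) ∘ swap) ∘ (st _ _ ∘ swap)     ≡⟨ cong F₁ (sym swap∘×₁) ⟩∘⟨refl ⟩
      F₁ (swap ∘ (g ×₁ f)) ∘ (st _ _ ∘ swap)     ≡⟨ sym F-mergeˡ ⟩
      F₁ swap ∘ (F₁ (g ×₁ f) ∘ (st _ _ ∘ swap))  ≡⟨ refl⟩∘⟨ trans (pullˡ (st-natural g f)) assoc ⟩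
      F₁ swap ∘ (st _ _ ∘ ((g ×₁ F₁ f) ∘ swap))  ≡⟨ refl⟩∘⟨ refl⟩∘⟨ sym swap∘×₁ ⟩
      F₁ swap ∘ (st _ _ ∘ (swap ∘ (F₁ f ×₁ g)))  ≡⟨ trans (refl⟩∘⟨ sym assoc) (sym assoc) ⟩
      st′ _ _ ∘ (F₁ f ×₁ g)                       ∎

    st′-natural₂ : {g : Hom X B} → F₁ (id {W} ×₁ g) ∘ st′ W X ≡ st′ W B ∘ (id ×₁ g)
    st′-natural₂ = trans st′-natural (refl⟩∘⟨ cong (_×₁ _) F-id)

    st′-η : st′ W X ∘ (η W ×₁ id) ≡ η (W ⊗ X)
    st′-η = begin
      (F₁ swap ∘ (st _ _ ∘ swap)) ∘ (η _ ×₁ id)  ≡⟨ pullʳ (pullʳ swap∘×₁) ⟩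
      F₁ swap ∘ (st _ _ ∘ ((id ×₁ η _) ∘ swap))  ≡⟨ refl⟩∘⟨ pullˡ (st-η _ _) ⟩
      F₁ swap ∘ (η _ ∘ swap)                     ≡⟨ extendʳ (η-natural swap) ⟩
      η _ ∘ (swap ∘ swap)                        ≡⟨ trans (refl⟩∘⟨ swap∘swap) identityʳ ⟩
      η _                                        ∎

    st′-μ : st′ W X ∘ (μ W ×₁ id) ≡ μ (W ⊗ X) ∘ (F₁ (st′ W X) ∘ st′ (F₀ W) X)
    st′-μ = begin
      (F₁ swap ∘ (st _ _ ∘ swap)) ∘ (μ _ ×₁ id)                      ≡⟨ pullʳ (pullʳ swap∘×₁) ⟩
      F₁ swap ∘ (st _ _ ∘ ((id ×₁ μ _) ∘ swap))                      ≡⟨ refl⟩∘⟨ trans (pullˡ (st-μ _ _)) (trans assoc (refl⟩∘⟨ assoc)) ⟩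
      F₁ swap ∘ (μ _ ∘ (F₁ (st _ _) ∘ (st _ _ ∘ swap)))              ≡⟨ extendʳ (μ-natural swap) ⟩
      μ _ ∘ (F₁ (F₁ swap) ∘ (F₁ (st _ _) ∘ (st _ _ ∘ swap)))         ≡⟨ refl⟩∘⟨ F-mergeˡ ⟩
      μ _ ∘ (F₁ (F₁ swap ∘ st _ _) ∘ (st _ _ ∘ swap))                ≡⟨ refl⟩∘⟨ cong F₁ (sym unswap) ⟩∘⟨refl ⟩
      μ _ ∘ (F₁ (st′ _ _ ∘ swap) ∘ (st _ _ ∘ swap))                  ≡⟨ refl⟩∘⟨ trans (F-∘ ⟩∘⟨refl) assoc ⟩
      μ _ ∘ (F₁ (st′ _ _) ∘ (F₁ swap ∘ (st _ _ ∘ swap)))             ∎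
      where
        unswap : st′ W X ∘ swap ≡ F₁ swap ∘ st X W
        unswap = trans assoc (refl⟩∘⟨ trans assoc (trans (refl⟩∘⟨ swap∘swap) identityʳ))

    st′-assoc : st′ (W ⊗ A) B ∘ (st′ W A ×₁ id) ≡ F₁ α⇐ ∘ (st′ W (A ⊗ B) ∘ α⇒)
    st′-assoc = begin
      (F₁ swap ∘ (st _ _ ∘ swap)) ∘ (st′ _ _ ×₁ id)
        ≡⟨ pullʳ (pullʳ swap∘×₁) ⟩
      F₁ swap ∘ (st _ _ ∘ ((id ×₁ (F₁ swap ∘ (st _ _ ∘ swap))) ∘ swap))
        ≡⟨ refl⟩∘⟨ refl⟩∘⟨ trans (sym (trans (refl⟩∘⟨ id×₁∘id×₁) id×₁∘id×₁) ⟩∘⟨refl) (trans assoc (refl⟩∘⟨ assoc)) ⟩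
      F₁ swap ∘ (st _ _ ∘ ((id ×₁ F₁ swap) ∘ ((id ×₁ st _ _) ∘ ((id ×₁ swap) ∘ swap))))
        ≡⟨ refl⟩∘⟨ extendʳ (sym st-natural₂) ⟩
      F₁ swap ∘ (F₁ (id ×₁ swap) ∘ (st _ _ ∘ ((id ×₁ st _ _) ∘ ((id ×₁ swap) ∘ swap))))
        ≡⟨ refl⟩∘⟨ refl⟩∘⟨ trans (pullˡ st∘id×₁st) (trans assoc (refl⟩∘⟨ assoc)) ⟩
      F₁ swap ∘ (F₁ (id ×₁ swap) ∘ (F₁ α⇒ ∘ (st _ _ ∘ (α⇐ ∘ ((id ×₁ swap) ∘ swap)))))
        ≡⟨ refl⟩∘⟨ refl⟩∘⟨ refl⟩∘⟨ refl⟩∘⟨ α⇐∘id×₁swap∘swap ⟩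
      F₁ swap ∘ (F₁ (id ×₁ swap) ∘ (F₁ α⇒ ∘ (st _ _ ∘ ((swap ×₁ id) ∘ (swap ∘ α⇒)))))
        ≡⟨ refl⟩∘⟨ refl⟩∘⟨ refl⟩∘⟨ extendʳ (sym st-natural₁) ⟩
      F₁ swap ∘ (F₁ (id ×₁ swap) ∘ (F₁ α⇒ ∘ (F₁ (swap ×₁ id) ∘ (st _ _ ∘ (swap ∘ α⇒)))))
        ≡⟨ trans (refl⟩∘⟨ trans (refl⟩∘⟨ F-mergeˡ) F-mergeˡ) F-mergeˡ ⟩
      F₁ (swap ∘ ((id ×₁ swap) ∘ (α⇒ ∘ (swap ×₁ id)))) ∘ (st _ _ ∘ (swap ∘ α⇒))
        ≡⟨ trans (cong F₁ swap∘id×₁swap∘α⇒∘swap×₁id) F-∘ ⟩∘⟨refl ⟩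
      (F₁ α⇐ ∘ F₁ swap) ∘ (st _ _ ∘ (swap ∘ α⇒))
        ≡⟨ trans assoc (refl⟩∘⟨ trans (refl⟩∘⟨ sym assoc) (sym assoc)) ⟩
      F₁ α⇐ ∘ (st′ _ _ ∘ α⇒)
        ∎
      where
        α⇐∘id×₁swap∘swap : ∀ {A B D} → α⇐ ∘ ((id ×₁ swap) ∘ swap) ≡ (swap ×₁ id) ∘ (swap ∘ α⇒ {A} {B} {D})
        α⇐∘id×₁swap∘swap = begin
          α⇐ ∘ ((id ×₁ swap) ∘ swap)                ≡⟨ refl⟩∘⟨ trans ×₁∘⟨⟩ (⟨⟩-cong₂ identityˡ ⟨⟩∘) ⟩
          α⇐ ∘ ⟨ π₂ , ⟨ π₂ ∘ π₁ , π₁ ∘ π₁ ⟩ ⟩        ≡⟨ α⇐∘⟨⟨⟩⟩ ⟩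
          ⟨ ⟨ π₂ , π₂ ∘ π₁ ⟩ , π₁ ∘ π₁ ⟩             ≡⟨ sym (trans (refl⟩∘⟨ swap∘⟨⟩) (trans ×₁∘⟨⟩ (⟨⟩-cong₂ swap∘⟨⟩ identityˡ))) ⟩
          (swap ×₁ id) ∘ (swap ∘ α⇒)                ∎
        swap∘id×₁swap∘α⇒∘swap×₁id : ∀ {A B D} → swap ∘ ((id ×₁ swap) ∘ (α⇒ ∘ (swap ×₁ id))) ≡ α⇐ ∘ swap {A ⊗ B} {D}
        swap∘id×₁swap∘α⇒∘swap×₁id = begin
          swap ∘ ((id ×₁ swap) ∘ (α⇒ ∘ (swap ×₁ id)))     ≡⟨ refl⟩∘⟨ refl⟩∘⟨ trans (refl⟩∘⟨ ⟨⟩-cong₂ ⟨⟩∘ identityˡ) α⇒∘⟨⟨⟩⟩ ⟩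
          swap ∘ ((id ×₁ swap) ∘ ⟨ π₂ ∘ π₁ , ⟨ π₁ ∘ π₁ , π₂ ⟩ ⟩) ≡⟨ refl⟩∘⟨ trans ×₁∘⟨⟩ (⟨⟩-cong₂ identityˡ swap∘⟨⟩) ⟩
          swap ∘ ⟨ π₂ ∘ π₁ , ⟨ π₂ , π₁ ∘ π₁ ⟩ ⟩           ≡⟨ swap∘⟨⟩ ⟩
          ⟨ ⟨ π₂ , π₁ ∘ π₁ ⟩ , π₂ ∘ π₁ ⟩                  ≡⟨ sym α⇐∘⟨⟩ ⟩
          α⇐ ∘ swap                                       ∎

    st′∘st×₁id : st′ (X ⊗ W) A ∘ (st X W ×₁ id) ≡ F₁ α⇐ ∘ (st X (W ⊗ A) ∘ ((id ×₁ st′ W A) ∘ α⇒))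
    st′∘st×₁id = begin
      (F₁ swap ∘ (st _ _ ∘ swap)) ∘ (st _ _ ×₁ id)
        ≡⟨ pullʳ (pullʳ swap∘×₁) ⟩
      F₁ swap ∘ (st _ _ ∘ ((id ×₁ st _ _) ∘ swap))
        ≡⟨ refl⟩∘⟨ trans (pullˡ st∘id×₁st) (trans assoc (refl⟩∘⟨ assoc)) ⟩
      F₁ swap ∘ (F₁ α⇒ ∘ (st _ _ ∘ (α⇐ ∘ swap)))
        ≡⟨ refl⟩∘⟨ refl⟩∘⟨ refl⟩∘⟨ α⇐∘swap ⟩
      F₁ swap ∘ (F₁ α⇒ ∘ (st _ _ ∘ ((swap ×₁ id) ∘ exchange)))
        ≡⟨ refl⟩∘⟨ refl⟩∘⟨ extendʳ (sym st-natural₁) ⟩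
      F₁ swap ∘ (F₁ α⇒ ∘ (F₁ (swap ×₁ id) ∘ (st _ _ ∘ exchange)))
        ≡⟨ trans (refl⟩∘⟨ F-mergeˡ) F-mergeˡ ⟩
      F₁ (swap ∘ (α⇒ ∘ (swap ×₁ id))) ∘ (st _ _ ∘ exchange)
        ≡⟨ cong F₁ swap∘α⇒∘swap×₁id ⟩∘⟨refl ⟩
      F₁ exchange ∘ (st _ _ ∘ exchange)
        ≡⟨ sym (trans (refl⟩∘⟨ trans (refl⟩∘⟨ trans (pullˡ st∘id×₁st) (trans assoc (refl⟩∘⟨ assoc))) F-mergeˡ) F-mergeˡ) ⟩
      F₁ α⇐ ∘ (F₁ (id ×₁ swap) ∘ (st _ _ ∘ ((id ×₁ st _ _) ∘ ((id ×₁ swap) ∘ α⇒))))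
        ≡⟨ refl⟩∘⟨ extendʳ st-natural₂ ⟩
      F₁ α⇐ ∘ (st _ _ ∘ ((id ×₁ F₁ swap) ∘ ((id ×₁ st _ _) ∘ ((id ×₁ swap) ∘ α⇒))))
        ≡⟨ refl⟩∘⟨ refl⟩∘⟨ trans (refl⟩∘⟨ sym assoc) (trans (sym assoc) (trans (refl⟩∘⟨ id×₁∘id×₁) id×₁∘id×₁ ⟩∘⟨refl)) ⟩
      F₁ α⇐ ∘ (st _ _ ∘ ((id ×₁ st′ _ _) ∘ α⇒))
        ∎
      where
        exchange : ∀ {A B D} → Hom ((A ⊗ B) ⊗ D) ((A ⊗ D) ⊗ B)
        exchange = α⇐ ∘ ((id ×₁ swap) ∘ α⇒)
        exchange≡⟨⟩ : ∀ {A B D} → exchange ≡ ⟨ ⟨ π₁ {A} {B} ∘ π₁ , π₂ {_} {D} ⟩ , π₂ ∘ π₁ ⟩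
        exchange≡⟨⟩ {A} {B} {D} = trans (refl⟩∘⟨ trans ×₁∘⟨⟩ (⟨⟩-cong₂ identityˡ swap∘⟨⟩)) (α⇐∘⟨⟨⟩⟩ {A = (A ⊗ B) ⊗ D})
        α⇐∘swap : ∀ {A B D} → α⇐ ∘ swap ≡ (swap ×₁ id) ∘ exchange {A} {B} {D}
        α⇐∘swap = trans α⇐∘⟨⟩ (sym (trans (refl⟩∘⟨ exchange≡⟨⟩) (trans ×₁∘⟨⟩ (⟨⟩-cong₂ swap∘⟨⟩ identityˡ))))
        swap∘α⇒∘swap×₁id : ∀ {A B D} → swap ∘ (α⇒ ∘ (swap ×₁ id)) ≡ exchange {A} {B} {D}
        swap∘α⇒∘swap×₁id = trans (refl⟩∘⟨ trans (refl⟩∘⟨ ⟨⟩-cong₂ ⟨⟩∘ identityˡ) α⇒∘⟨⟨⟩⟩) (trans swap∘⟨⟩ (sym exchange≡⟨⟩))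

    st′-point : {Z : Obj} {e : Hom ⊤ Z} → st′ W Z ∘ ⟨ id , e ∘ ! ⟩ ≡ F₁ ⟨ id , e ∘ ! ⟩
    st′-point {W = W} {e = e} = begin
      st′ _ _ ∘ ⟨ id , e ∘ ! ⟩           ≡⟨ refl⟩∘⟨ sym (trans ×₁∘⟨⟩ (⟨⟩-cong₂ identityˡ refl)) ⟩
      st′ _ _ ∘ ((id ×₁ e) ∘ ⟨ id , ! ⟩) ≡⟨ extendʳ (sym st′-natural₂) ⟩
      F₁ (id ×₁ e) ∘ (st′ _ _ ∘ ⟨ id , ! ⟩) ≡⟨ trans (refl⟩∘⟨ st′-⊤) F-merge ⟩
      F₁ ((id ×₁ e) ∘ ⟨ id , ! ⟩)        ≡⟨ cong F₁ (trans ×₁∘⟨⟩ (⟨⟩-cong₂ identityˡ refl)) ⟩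
      F₁ ⟨ id , e ∘ ! ⟩                   ∎
      where
        st-⊤ : st ⊤ W ∘ ⟨ ! , id ⟩ ≡ F₁ ⟨ ! , id ⟩
        st-⊤ = begin
          st _ _ ∘ ⟨ ! , id ⟩                                  ≡⟨ sym identityˡ ⟩
          id ∘ (st _ _ ∘ ⟨ ! , id ⟩)                           ≡⟨ sym (trans (cong F₁ ⟨!,id⟩∘π₂) F-id) ⟩∘⟨refl ⟩
          F₁ (⟨ ! , id ⟩ ∘ π₂) ∘ (st _ _ ∘ ⟨ ! , id ⟩)         ≡⟨ trans (F-∘ ⟩∘⟨refl) (pullʳ (pullˡ (st-unit _))) ⟩
          F₁ ⟨ ! , id ⟩ ∘ (π₂ ∘ ⟨ ! , id ⟩)                    ≡⟨ trans (refl⟩∘⟨ π₂∘⟨⟩) identityʳ ⟩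
          F₁ ⟨ ! , id ⟩                                        ∎
          where
            ⟨!,id⟩∘π₂ : ⟨ ! , id ⟩ ∘ π₂ ≡ id {⊤ ⊗ W}
            ⟨!,id⟩∘π₂ = ⟨⟩-ext (trans (pullˡ π₁∘⟨⟩) (trans (!-unique _) (sym (!-unique _))))
                               (trans (pullˡ π₂∘⟨⟩) (trans identityˡ (sym identityʳ)))
        st′-⊤ : st′ W ⊤ ∘ ⟨ id , ! ⟩ ≡ F₁ ⟨ id , ! ⟩
        st′-⊤ = trans (pullʳ (pullʳ swap∘⟨⟩)) (trans (refl⟩∘⟨ st-⊤) (trans F-merge (cong F₁ swap∘⟨⟩)))

    Λ⁻¹-u∘F₁ : ∀ {A X Y} {g : Hom A (X ^ Y)} → Λ⁻¹ (u C T Y X ∘ F₁ g) ≡ F₁ (Λ⁻¹ g) ∘ st′ A Y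
    Λ⁻¹-u∘F₁ {g = g} = begin
      Λ⁻¹ (u C T _ _ ∘ F₁ g)                    ≡⟨ trans Λ⁻¹-∘ (Λ⁻¹-Λ ⟩∘⟨refl) ⟩
      (F₁ (ev _ _) ∘ st′ _ _) ∘ (F₁ g ×₁ id)    ≡⟨ pullʳ (sym st′-natural) ⟩
      F₁ (ev _ _) ∘ (F₁ (g ×₁ id) ∘ st′ _ _)    ≡⟨ F-mergeˡ ⟩
      F₁ (Λ⁻¹ g) ∘ st′ _ _                       ∎

  module WriterToState (M : MonoidObject C) (Y : Obj) (α : ∀ X → Hom (X ⊗ MonoidObject.Z M) ((X ⊗ Y) ^ Y))
                       (α-morphism : IsStrongMonadMorphism C (Writer C M) (State C Y) α) where
    open MonoidObject M
    open IsStrongMonadMorphism α-morphism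

    α♭ : ∀ X → Hom ((X ⊗ Z) ⊗ Y) (X ⊗ Y)
    α♭ X = Λ⁻¹ (α X)

    α♭-natural : {f : Hom A B} → (f ×₁ id) ∘ α♭ A ≡ α♭ B ∘ ((f ×₁ id) ×₁ id)
    α♭-natural {f = f} = trans (sym Λ⁻¹-^₁) (trans (cong Λ⁻¹ (natural f)) Λ⁻¹-∘)

    α♭-η : α♭ X ∘ (⟨ id , e ∘ ! ⟩ ×₁ id) ≡ id
    α♭-η {X = X} = begin
      α♭ X ∘ (⟨ id , e ∘ ! ⟩ ×₁ id) ≡⟨ sym Λ⁻¹-∘ ⟩
      Λ⁻¹ (α X ∘ ⟨ id , e ∘ ! ⟩)    ≡⟨ cong Λ⁻¹ (pres-η X) ⟩
      Λ⁻¹ (Λ id)                     ≡⟨ Λ⁻¹-Λ ⟩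
      id                             ∎

    α♭-μ : α♭ X ∘ (((id ×₁ m) ∘ α⇒) ×₁ id) ≡ α♭ X ∘ α♭ (X ⊗ Z)
    α♭-μ {X = X} = begin
      α♭ X ∘ (((id ×₁ m) ∘ α⇒) ×₁ id)                                      ≡⟨ sym Λ⁻¹-∘ ⟩
      Λ⁻¹ (α X ∘ ((id ×₁ m) ∘ α⇒))                                         ≡⟨ cong Λ⁻¹ (pres-μ X) ⟩
      Λ⁻¹ (((id ∘ ev _ _) ^₁ Y) ∘ ((α X ×₁ id) ^₁ Y) ∘ α (X ⊗ Z))         ≡⟨ trans Λ⁻¹-^₁ (refl⟩∘⟨ Λ⁻¹-^₁) ⟩
      (id ∘ ev _ _) ∘ ((α X ×₁ id) ∘ α♭ (X ⊗ Z))                           ≡⟨ trans (identityˡ ⟩∘⟨refl) (sym assoc) ⟩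
      α♭ X ∘ α♭ (X ⊗ Z)                                                     ∎

    α♭-st : α♭ (X ⊗ W) ∘ (α⇐ ×₁ id) ≡ α⇐ ∘ ((id ×₁ α♭ W) ∘ α⇒)
    α♭-st {X = X} {W = W} = begin
      α♭ (X ⊗ W) ∘ (α⇐ ×₁ id)                                          ≡⟨ sym Λ⁻¹-∘ ⟩
      Λ⁻¹ (α (X ⊗ W) ∘ α⇐)                                             ≡⟨ cong Λ⁻¹ (pres-st X W) ⟩
      Λ⁻¹ (Λ (α⇐ ∘ (id ∘ ((id ×₁ ev _ _) ∘ α⇒))) ∘ (id ×₁ α W))        ≡⟨ trans Λ⁻¹-∘ (Λ⁻¹-Λ ⟩∘⟨refl) ⟩
      (α⇐ ∘ (id ∘ ((id ×₁ ev _ _) ∘ α⇒))) ∘ ((id ×₁ α W) ×₁ id)        ≡⟨ pullʳ (trans (identityˡ ⟩∘⟨refl) assoc) ⟩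
      α⇐ ∘ ((id ×₁ ev _ _) ∘ (α⇒ ∘ ((id ×₁ α W) ×₁ id)))               ≡⟨ refl⟩∘⟨ refl⟩∘⟨ α⇒∘×₁ ⟩
      α⇐ ∘ ((id ×₁ ev _ _) ∘ ((id ×₁ (α W ×₁ id)) ∘ α⇒))               ≡⟨ refl⟩∘⟨ pullˡ id×₁∘id×₁ ⟩
      α⇐ ∘ ((id ×₁ α♭ W) ∘ α⇒)                                          ∎

    action : Hom (Z ⊗ Y) Y
    action = π₂ ∘ (α♭ ⊤ ∘ ⟨ ⟨ ! , π₁ ⟩ , π₂ ⟩)

    α♭∘α⇐ : α♭ X ∘ α⇐ ≡ id ×₁ action
    α♭∘α⇐ {X = X} = begin
      α♭ X ∘ α⇐                                                  ≡⟨ refl⟩∘⟨ sym forget-⊤ ⟩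
      α♭ X ∘ (((π₁ ×₁ id) ×₁ id) ∘ ((α⇐ ×₁ id) ∘ insert-⊤))     ≡⟨ pullˡ (sym α♭-natural) ⟩
      ((π₁ ×₁ id) ∘ α♭ (X ⊗ ⊤)) ∘ ((α⇐ ×₁ id) ∘ insert-⊤)       ≡⟨ pullʳ (pullˡ α♭-st) ⟩
      (π₁ ×₁ id) ∘ ((α⇐ ∘ ((id ×₁ α♭ ⊤) ∘ α⇒)) ∘ insert-⊤)      ≡⟨ refl⟩∘⟨ trans assoc (refl⟩∘⟨ assoc) ⟩
      (π₁ ×₁ id) ∘ (α⇐ ∘ ((id ×₁ α♭ ⊤) ∘ (α⇒ ∘ insert-⊤)))      ≡⟨ pullˡ π₁×₁id∘α⇐ ⟩
      (id ×₁ π₂) ∘ ((id ×₁ α♭ ⊤) ∘ (α⇒ ∘ insert-⊤))             ≡⟨ refl⟩∘⟨ refl⟩∘⟨ α⇒∘insert-⊤ ⟩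
      (id ×₁ π₂) ∘ ((id ×₁ α♭ ⊤) ∘ (id ×₁ ⟨ ⟨ ! , π₁ ⟩ , π₂ ⟩)) ≡⟨ trans (refl⟩∘⟨ id×₁∘id×₁) id×₁∘id×₁ ⟩
      id ×₁ action                                                ∎
      where
        insert-⊤ : Hom (X ⊗ (Z ⊗ Y)) ((X ⊗ (⊤ ⊗ Z)) ⊗ Y)
        insert-⊤ = ⟨ ⟨ π₁ , ⟨ ! , π₁ ∘ π₂ ⟩ ⟩ , π₂ ∘ π₂ ⟩
        forget-⊤ : ((π₁ ×₁ id) ×₁ id) ∘ ((α⇐ ×₁ id) ∘ insert-⊤) ≡ α⇐
        forget-⊤ = trans (refl⟩∘⟨ trans ×₁∘⟨⟩ (⟨⟩-cong₂ α⇐∘⟨⟨⟩⟩ refl))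
                         (trans ×₁∘⟨⟩ (⟨⟩-cong₂ (trans ×₁∘⟨⟩ (⟨⟩-cong₂ π₁∘⟨⟩ identityˡ)) (trans identityˡ identityˡ)))
        π₁×₁id∘α⇐ : (π₁ ×₁ id) ∘ α⇐ ≡ id ×₁ π₂ {⊤} {Y}
        π₁×₁id∘α⇐ = trans ×₁∘⟨⟩ (⟨⟩-cong₂ (trans π₁∘⟨⟩ (sym identityˡ)) identityˡ)
        α⇒∘insert-⊤ : α⇒ ∘ insert-⊤ ≡ id ×₁ ⟨ ⟨ ! , π₁ ⟩ , π₂ ⟩
        α⇒∘insert-⊤ = trans α⇒∘⟨⟨⟩⟩ (sym (⟨⟩-cong₂ identityˡ (trans ⟨⟩∘ (⟨⟩-cong₂ (trans ⟨⟩∘ (⟨⟩-cong₂ (!-unique _) refl)) refl))))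

  module LiftedAlgebras (T : RawStrongMonad C) (isT : IsStrongMonad C T) where
    open RightStrength T isT
    open RawStrongMonad T
    open IsStrongMonad isT

    module WriterAlgebra (M : MonoidObject C) {Ω : Obj} {τ : Hom (Ω ⊗ MonoidObject.Z M) Ω}
                         (τ-algebra : IsEMAlgebra C (Writer C M) Ω τ) where
      open MonoidObject M
      open IsEMAlgebra τ-algebra

      lifted-action : Hom (F₀ Ω ⊗ Z) (F₀ Ω)
      lifted-action = F₁ τ ∘ st′ Ω Z

      lifted-action-algebra : IsEMAlgebra C (Writer C M) (F₀ Ω) lifted-action
      lifted-action-algebra = record
        { unit = trans (pullʳ st′-point) (trans F-merge (trans (cong F₁ unit) F-id))
        ; mult = begin
            lifted-action ∘ ((id ×₁ m) ∘ α⇒)                          ≡⟨ pullʳ (extendʳ (sym st′-natural₂)) ⟩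
            F₁ τ ∘ (F₁ (id ×₁ m) ∘ (st′ _ _ ∘ α⇒))                    ≡⟨ F-mergeˡ ⟩
            F₁ (τ ∘ (id ×₁ m)) ∘ (st′ _ _ ∘ α⇒)                       ≡⟨ cong F₁ τ∘id×₁m ⟩∘⟨refl ⟩
            F₁ ((τ ∘ (τ ×₁ id)) ∘ α⇐) ∘ (st′ _ _ ∘ α⇒)                ≡⟨ sym F-mergeˡ ⟩
            F₁ (τ ∘ (τ ×₁ id)) ∘ (F₁ α⇐ ∘ (st′ _ _ ∘ α⇒))             ≡⟨ refl⟩∘⟨ sym st′-assoc ⟩
            F₁ (τ ∘ (τ ×₁ id)) ∘ (st′ _ _ ∘ (st′ _ _ ×₁ id))          ≡⟨ trans (F-∘ ⟩∘⟨refl) assoc ⟩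
            F₁ τ ∘ (F₁ (τ ×₁ id) ∘ (st′ _ _ ∘ (st′ _ _ ×₁ id)))       ≡⟨ refl⟩∘⟨ extendʳ st′-natural ⟩
            F₁ τ ∘ (st′ _ _ ∘ ((F₁ τ ×₁ id) ∘ (st′ _ _ ×₁ id)))       ≡⟨ trans (refl⟩∘⟨ refl⟩∘⟨ ×₁id∘×₁id) (sym assoc) ⟩
            lifted-action ∘ (lifted-action ×₁ id)                     ∎
        }
        where
          τ∘id×₁m : τ ∘ (id ×₁ m) ≡ (τ ∘ (τ ×₁ id)) ∘ α⇐
          τ∘id×₁m = trans (sym (pullʳ (trans assoc (trans (refl⟩∘⟨ α⇒∘α⇐) identityʳ)))) (mult ⟩∘⟨refl)

      TWriter-algebra : IsEMAlgebra C (TWriter C T M) (F₀ Ω) (μ Ω ∘ (F₁ (F₁ τ) ∘ F₁ (st′ Ω Z)))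
      TWriter-algebra = record
        { unit = begin
            τ♯ ∘ (η _ ∘ ⟨ id , e ∘ ! ⟩)                   ≡⟨ trans (τ♯≡ ⟩∘⟨refl) assoc ⟩
            μ _ ∘ (F₁ lifted-action ∘ (η _ ∘ ⟨ id , e ∘ ! ⟩)) ≡⟨ refl⟩∘⟨ extendʳ (η-natural _) ⟩
            μ _ ∘ (η _ ∘ (lifted-action ∘ ⟨ id , e ∘ ! ⟩))  ≡⟨ cancelˡ (μ-unitˡ _) ⟩
            lifted-action ∘ ⟨ id , e ∘ ! ⟩                  ≡⟨ IsEMAlgebra.unit lifted-action-algebra ⟩
            id                                              ∎
        ; mult = begin
            τ♯ ∘ (F₁ m⊗ ∘ (μ _ ∘ F₁ (st′ _ _)))                         ≡⟨ trans (τ♯≡ ⟩∘⟨refl) assoc ⟩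
            μ _ ∘ (F₁ lifted-action ∘ (F₁ m⊗ ∘ (μ _ ∘ F₁ (st′ _ _))))   ≡⟨ refl⟩∘⟨ trans F-mergeˡ (extendʳ (μ-natural _)) ⟩
            μ _ ∘ (μ _ ∘ (F₁ (F₁ (lifted-action ∘ m⊗)) ∘ F₁ (st′ _ _))) ≡⟨ extendʳ (sym (μ-assoc _)) ⟩
            μ _ ∘ (F₁ (μ _) ∘ (F₁ (F₁ (lifted-action ∘ m⊗)) ∘ F₁ (st′ _ _))) ≡⟨ refl⟩∘⟨ trans (refl⟩∘⟨ F-merge) F-merge ⟩
            μ _ ∘ F₁ (μ _ ∘ (F₁ (lifted-action ∘ m⊗) ∘ st′ _ _))         ≡⟨ refl⟩∘⟨ cong F₁ μ-compatible ⟩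
            μ _ ∘ F₁ (lifted-action ∘ (τ♯ ×₁ id))                        ≡⟨ trans (refl⟩∘⟨ F-∘) (pullˡ (sym τ♯≡)) ⟩
            τ♯ ∘ F₁ (τ♯ ×₁ id)                                           ∎
        }
        where
          τ♯ : Hom (F₀ (F₀ Ω ⊗ Z)) (F₀ Ω)
          τ♯ = μ Ω ∘ (F₁ (F₁ τ) ∘ F₁ (st′ Ω Z))
          τ♯≡ : τ♯ ≡ μ Ω ∘ F₁ lifted-action
          τ♯≡ = refl⟩∘⟨ F-merge
          m⊗ : Hom ((F₀ Ω ⊗ Z) ⊗ Z) (F₀ Ω ⊗ Z)
          m⊗ = (id ×₁ m) ∘ α⇒
          μ-compatible : μ Ω ∘ (F₁ (lifted-action ∘ m⊗) ∘ st′ (F₀ Ω ⊗ Z) Z) ≡ lifted-action ∘ (τ♯ ×₁ id)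
          μ-compatible = sym (begin
            lifted-action ∘ (τ♯ ×₁ id)                                     ≡⟨ refl⟩∘⟨ trans (cong (_×₁ id) τ♯≡) (sym ×₁id∘×₁id) ⟩
            (F₁ τ ∘ st′ _ _) ∘ ((μ _ ×₁ id) ∘ (F₁ lifted-action ×₁ id))   ≡⟨ pullʳ (pullˡ st′-μ) ⟩
            F₁ τ ∘ ((μ _ ∘ (F₁ (st′ _ _) ∘ st′ _ _)) ∘ (F₁ lifted-action ×₁ id)) ≡⟨ refl⟩∘⟨ pullʳ (pullʳ (sym st′-natural)) ⟩
            F₁ τ ∘ (μ _ ∘ (F₁ (st′ _ _) ∘ (F₁ (lifted-action ×₁ id) ∘ st′ _ _))) ≡⟨ extendʳ (μ-natural _) ⟩
            μ _ ∘ (F₁ (F₁ τ) ∘ (F₁ (st′ _ _) ∘ (F₁ (lifted-action ×₁ id) ∘ st′ _ _))) ≡⟨ refl⟩∘⟨ trans (refl⟩∘⟨ F-mergeˡ) F-mergeˡ ⟩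
            μ _ ∘ (F₁ (F₁ τ ∘ (st′ _ _ ∘ (lifted-action ×₁ id))) ∘ st′ _ _) ≡⟨ refl⟩∘⟨ cong F₁ (trans (sym assoc) (sym (IsEMAlgebra.mult lifted-action-algebra))) ⟩∘⟨refl ⟩
            μ _ ∘ (F₁ (lifted-action ∘ m⊗) ∘ st′ _ _)                       ∎)

    module StateAlgebra (Y : Obj) {Ω : Obj} {τ : Hom (F₀ Ω) Ω} (τ-algebra : IsEMAlgebra C T Ω τ) where
      open IsEMAlgebra τ-algebra

      StateT-algebra : IsEMAlgebra C (StateT C T Y) (Ω ^ Y) ((τ ^₁ Y) ∘ (F₁ (ev Ω Y) ^₁ Y))
      StateT-algebra = record
        { unit = Λ⁻¹-injective (begin
            Λ⁻¹ (τ♯ ∘ Λ (η _))                                     ≡⟨ trans (cong Λ⁻¹ assoc) (trans Λ⁻¹-^₁ (refl⟩∘⟨ trans Λ⁻¹-^₁ (refl⟩∘⟨ Λ⁻¹-Λ))) ⟩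
            τ ∘ (F₁ (ev _ _) ∘ η _)                                ≡⟨ refl⟩∘⟨ η-natural _ ⟩
            τ ∘ (η _ ∘ ev _ _)                                     ≡⟨ trans (pullˡ unit) identityˡ ⟩
            ev _ _                                                 ≡⟨ sym (trans (refl⟩∘⟨ id×₁id) identityʳ) ⟩
            Λ⁻¹ id                                                 ∎)
        ; mult = begin
            τ♯ ∘ ((μ _ ∘ F₁ (ev _ _)) ^₁ Y)                         ≡⟨ trans assoc (trans (refl⟩∘⟨ ^₁∘^₁) ^₁∘^₁) ⟩
            (τ ∘ (F₁ (ev _ _) ∘ (μ _ ∘ F₁ (ev _ _)))) ^₁ Y          ≡⟨ cong (_^₁ Y) inner ⟩
            (τ ∘ (F₁ (ev _ _) ∘ F₁ (τ♯ ×₁ id))) ^₁ Y                ≡⟨ sym (trans assoc (trans (refl⟩∘⟨ ^₁∘^₁) ^₁∘^₁)) ⟩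
            τ♯ ∘ (F₁ (τ♯ ×₁ id) ^₁ Y)                                ∎
        }
        where
          τ♯ : Hom (F₀ ((Ω ^ Y) ⊗ Y) ^ Y) (Ω ^ Y)
          τ♯ = (τ ^₁ Y) ∘ (F₁ (ev Ω Y) ^₁ Y)
          Λ⁻¹-τ♯ : Λ⁻¹ τ♯ ≡ τ ∘ (F₁ (ev Ω Y) ∘ ev _ _)
          Λ⁻¹-τ♯ = trans Λ⁻¹-^₁ (refl⟩∘⟨ Λ⁻¹-Λ)
          inner : τ ∘ (F₁ (ev Ω Y) ∘ (μ _ ∘ F₁ (ev (F₀ ((Ω ^ Y) ⊗ Y)) Y))) ≡ τ ∘ (F₁ (ev _ _) ∘ F₁ (τ♯ ×₁ id))
          inner = begin
            τ ∘ (F₁ (ev _ _) ∘ (μ _ ∘ F₁ (ev _ _)))            ≡⟨ refl⟩∘⟨ extendʳ (μ-natural _) ⟩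
            τ ∘ (μ _ ∘ (F₁ (F₁ (ev _ _)) ∘ F₁ (ev _ _)))       ≡⟨ extendʳ mult ⟩
            τ ∘ (F₁ τ ∘ (F₁ (F₁ (ev _ _)) ∘ F₁ (ev _ _)))      ≡⟨ refl⟩∘⟨ trans (refl⟩∘⟨ F-merge) F-merge ⟩
            τ ∘ F₁ (τ ∘ (F₁ (ev _ _) ∘ ev _ _))                ≡⟨ refl⟩∘⟨ cong F₁ (sym Λ⁻¹-τ♯) ⟩
            τ ∘ F₁ (Λ⁻¹ τ♯)                                     ≡⟨ refl⟩∘⟨ F-∘ ⟩
            τ ∘ (F₁ (ev _ _) ∘ F₁ (τ♯ ×₁ id))                  ∎

  module LiftedMorphism (T : RawStrongMonad C) (isT : IsStrongMonad C T)
                        (M : MonoidObject C) (Y : Obj) (α : ∀ X → Hom (X ⊗ MonoidObject.Z M) ((X ⊗ Y) ^ Y))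
                        (α-morphism : IsStrongMonadMorphism C (Writer C M) (State C Y) α) where
    open RightStrength T isT
    open WriterToState M Y α α-morphism
    open RawStrongMonad T
    open IsStrongMonad isT
    open MonoidObject M using (Z; e; m)

    β : ∀ X → Hom (F₀ (X ⊗ Z)) (F₀ (X ⊗ Y) ^ Y)
    β X = u C T Y (X ⊗ Y) ∘ F₁ (α X)

    Λ⁻¹-β : Λ⁻¹ (β X) ≡ F₁ (α♭ X) ∘ st′ (X ⊗ Z) Y
    Λ⁻¹-β = Λ⁻¹-u∘F₁

    F₁α♭∘st′∘st′×₁id : F₁ (α♭ W) ∘ (st′ (W ⊗ Z) Y ∘ (st′ W Z ×₁ id)) ≡ st′ W Y ∘ α♭ (F₀ W)
    F₁α♭∘st′∘st′×₁id {W = W} = begin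
      F₁ (α♭ W) ∘ (st′ _ _ ∘ (st′ _ _ ×₁ id)) ≡⟨ refl⟩∘⟨ st′-assoc ⟩
      F₁ (α♭ W) ∘ (F₁ α⇐ ∘ (st′ _ _ ∘ α⇒))    ≡⟨ F-mergeˡ ⟩
      F₁ (α♭ W ∘ α⇐) ∘ (st′ _ _ ∘ α⇒)         ≡⟨ cong F₁ α♭∘α⇐ ⟩∘⟨refl ⟩
      F₁ (id ×₁ action) ∘ (st′ _ _ ∘ α⇒)      ≡⟨ pullˡ st′-natural₂ ⟩
      (st′ _ _ ∘ (id ×₁ action)) ∘ α⇒         ≡⟨ pullʳ (sym α♭∘α⇐ ⟩∘⟨refl) ⟩
      st′ _ _ ∘ ((α♭ (F₀ W) ∘ α⇐) ∘ α⇒)       ≡⟨ refl⟩∘⟨ trans assoc (trans (refl⟩∘⟨ α⇐∘α⇒) identityʳ) ⟩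
      st′ _ _ ∘ α♭ (F₀ W)                      ∎

    β-natural : {f : Hom A B} → (F₁ (f ×₁ id) ^₁ Y) ∘ β A ≡ β B ∘ F₁ (f ×₁ id)
    β-natural {A = A} {B = B} {f = f} = Λ⁻¹-injective (begin
      Λ⁻¹ ((F₁ (f ×₁ id) ^₁ Y) ∘ β A)              ≡⟨ trans Λ⁻¹-^₁ (refl⟩∘⟨ Λ⁻¹-β) ⟩
      F₁ (f ×₁ id) ∘ (F₁ (α♭ A) ∘ st′ _ _)         ≡⟨ trans F-mergeˡ (cong F₁ α♭-natural ⟩∘⟨refl) ⟩
      F₁ (α♭ B ∘ ((f ×₁ id) ×₁ id)) ∘ st′ _ _      ≡⟨ cong F₁ (sym Λ⁻¹-∘) ⟩∘⟨refl ⟩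
      F₁ (Λ⁻¹ (α B ∘ (f ×₁ id))) ∘ st′ _ _         ≡⟨ sym Λ⁻¹-u∘F₁ ⟩
      Λ⁻¹ (u C T Y (B ⊗ Y) ∘ F₁ (α B ∘ (f ×₁ id))) ≡⟨ cong Λ⁻¹ (trans (refl⟩∘⟨ F-∘) (sym assoc)) ⟩
      Λ⁻¹ (β B ∘ F₁ (f ×₁ id))                     ∎)

    β-η : β X ∘ (η (X ⊗ Z) ∘ ⟨ id , e ∘ ! ⟩) ≡ Λ (η (X ⊗ Y))
    β-η {X = X} = Λ⁻¹-injective (begin
      Λ⁻¹ (β X ∘ (η _ ∘ ⟨ id , e ∘ ! ⟩))                                ≡⟨ trans Λ⁻¹-∘ (Λ⁻¹-β ⟩∘⟨ sym ×₁id∘×₁id) ⟩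
      (F₁ (α♭ X) ∘ st′ _ _) ∘ ((η _ ×₁ id) ∘ (⟨ id , e ∘ ! ⟩ ×₁ id))    ≡⟨ pullʳ (pullˡ st′-η) ⟩
      F₁ (α♭ X) ∘ (η _ ∘ (⟨ id , e ∘ ! ⟩ ×₁ id))                        ≡⟨ extendʳ (η-natural _) ⟩
      η _ ∘ (α♭ X ∘ (⟨ id , e ∘ ! ⟩ ×₁ id))                             ≡⟨ trans (refl⟩∘⟨ α♭-η) identityʳ ⟩
      η _                                                               ≡⟨ sym Λ⁻¹-Λ ⟩
      Λ⁻¹ (Λ (η (X ⊗ Y)))                                               ∎)

    β-μ : β X ∘ (F₁ ((id ×₁ m) ∘ α⇒) ∘ (μ ((X ⊗ Z) ⊗ Z) ∘ F₁ (st′ (X ⊗ Z) Z)))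
          ≡ ((μ (X ⊗ Y) ∘ F₁ (ev (F₀ (X ⊗ Y)) Y)) ^₁ Y) ∘ ((F₁ (β X ×₁ id) ^₁ Y) ∘ β (F₀ (X ⊗ Z)))
    β-μ {X = X} = Λ⁻¹-injective (trans lhs (sym rhs))
      where
        m⊗ : Hom ((X ⊗ Z) ⊗ Z) (X ⊗ Z)
        m⊗ = (id ×₁ m) ∘ α⇒
        common : Hom (F₀ (F₀ (X ⊗ Z) ⊗ Z) ⊗ Y) (F₀ (X ⊗ Y))
        common = μ _ ∘ (F₁ (Λ⁻¹ (β X) ∘ α♭ (F₀ (X ⊗ Z))) ∘ st′ _ _)
        lhs : Λ⁻¹ (β X ∘ (F₁ m⊗ ∘ (μ _ ∘ F₁ (st′ _ _)))) ≡ common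
        lhs = begin
          Λ⁻¹ (β X ∘ (F₁ m⊗ ∘ (μ _ ∘ F₁ (st′ _ _))))
            ≡⟨ trans Λ⁻¹-∘ (Λ⁻¹-β ⟩∘⟨ sym (trans (refl⟩∘⟨ ×₁id∘×₁id) ×₁id∘×₁id)) ⟩
          (F₁ (α♭ X) ∘ st′ _ _) ∘ ((F₁ m⊗ ×₁ id) ∘ ((μ _ ×₁ id) ∘ (F₁ (st′ _ _) ×₁ id)))
            ≡⟨ trans assoc (refl⟩∘⟨ extendʳ (sym st′-natural)) ⟩
          F₁ (α♭ X) ∘ (F₁ (m⊗ ×₁ id) ∘ (st′ _ _ ∘ ((μ _ ×₁ id) ∘ (F₁ (st′ _ _) ×₁ id))))
            ≡⟨ trans F-mergeˡ (cong F₁ α♭-μ ⟩∘⟨ pullˡ st′-μ) ⟩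
          F₁ (α♭ X ∘ α♭ (X ⊗ Z)) ∘ ((μ _ ∘ (F₁ (st′ _ _) ∘ st′ _ _)) ∘ (F₁ (st′ _ _) ×₁ id))
            ≡⟨ refl⟩∘⟨ pullʳ (pullʳ (sym st′-natural)) ⟩
          F₁ (α♭ X ∘ α♭ (X ⊗ Z)) ∘ (μ _ ∘ (F₁ (st′ _ _) ∘ (F₁ (st′ _ _ ×₁ id) ∘ st′ _ _)))
            ≡⟨ trans (extendʳ (μ-natural _)) (refl⟩∘⟨ trans (refl⟩∘⟨ F-mergeˡ) F-mergeˡ) ⟩
          μ _ ∘ (F₁ (F₁ (α♭ X ∘ α♭ (X ⊗ Z)) ∘ (st′ _ _ ∘ (st′ _ _ ×₁ id))) ∘ st′ _ _)
            ≡⟨ refl⟩∘⟨ cong F₁ (trans (F-∘ ⟩∘⟨refl) (pullʳ F₁α♭∘st′∘st′×₁id)) ⟩∘⟨refl ⟩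
          μ _ ∘ (F₁ (F₁ (α♭ X) ∘ (st′ _ _ ∘ α♭ (F₀ (X ⊗ Z)))) ∘ st′ _ _)
            ≡⟨ refl⟩∘⟨ cong F₁ (pullˡ (sym Λ⁻¹-β)) ⟩∘⟨refl ⟩
          common
            ∎
        rhs : Λ⁻¹ (((μ _ ∘ F₁ (ev _ _)) ^₁ Y) ∘ ((F₁ (β X ×₁ id) ^₁ Y) ∘ β (F₀ (X ⊗ Z)))) ≡ common
        rhs = begin
          Λ⁻¹ (((μ _ ∘ F₁ (ev _ _)) ^₁ Y) ∘ ((F₁ (β X ×₁ id) ^₁ Y) ∘ β (F₀ (X ⊗ Z))))
            ≡⟨ trans Λ⁻¹-^₁ (refl⟩∘⟨ trans Λ⁻¹-^₁ (refl⟩∘⟨ Λ⁻¹-β)) ⟩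
          (μ _ ∘ F₁ (ev _ _)) ∘ (F₁ (β X ×₁ id) ∘ (F₁ (α♭ (F₀ (X ⊗ Z))) ∘ st′ _ _))
            ≡⟨ pullʳ (trans F-mergeˡ F-mergeˡ) ⟩
          common
            ∎

    β-st : β (X ⊗ W) ∘ (F₁ α⇐ ∘ st X (W ⊗ Z))
           ≡ Λ (F₁ α⇐ ∘ (st X (W ⊗ Y) ∘ ((id ×₁ ev (F₀ (W ⊗ Y)) Y) ∘ α⇒))) ∘ (id ×₁ β W)
    β-st {X = X} {W = W} = Λ⁻¹-injective (trans lhs (sym rhs))
      where
        common : Hom ((X ⊗ F₀ (W ⊗ Z)) ⊗ Y) (F₀ ((X ⊗ W) ⊗ Y))
        common = F₁ (α⇐ ∘ (id ×₁ α♭ W)) ∘ (st X ((W ⊗ Z) ⊗ Y) ∘ ((id ×₁ st′ (W ⊗ Z) Y) ∘ α⇒))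
        lhs : Λ⁻¹ (β (X ⊗ W) ∘ (F₁ α⇐ ∘ st X (W ⊗ Z))) ≡ common
        lhs = begin
          Λ⁻¹ (β (X ⊗ W) ∘ (F₁ α⇐ ∘ st X (W ⊗ Z)))
            ≡⟨ trans Λ⁻¹-∘ (Λ⁻¹-β ⟩∘⟨ sym ×₁id∘×₁id) ⟩
          (F₁ (α♭ (X ⊗ W)) ∘ st′ _ _) ∘ ((F₁ α⇐ ×₁ id) ∘ (st _ _ ×₁ id))
            ≡⟨ trans (pullʳ (extendʳ (sym st′-natural))) F-mergeˡ ⟩
          F₁ (α♭ (X ⊗ W) ∘ (α⇐ ×₁ id)) ∘ (st′ _ _ ∘ (st _ _ ×₁ id))
            ≡⟨ cong F₁ α♭-st ⟩∘⟨ st′∘st×₁id ⟩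
          F₁ (α⇐ ∘ ((id ×₁ α♭ W) ∘ α⇒)) ∘ (F₁ α⇐ ∘ (st _ _ ∘ ((id ×₁ st′ _ _) ∘ α⇒)))
            ≡⟨ F-mergeˡ ⟩
          F₁ ((α⇐ ∘ ((id ×₁ α♭ W) ∘ α⇒)) ∘ α⇐) ∘ (st _ _ ∘ ((id ×₁ st′ _ _) ∘ α⇒))
            ≡⟨ cong F₁ (pullʳ (trans (pullʳ α⇒∘α⇐) identityʳ)) ⟩∘⟨refl ⟩
          common
            ∎
        rhs : Λ⁻¹ (Λ (F₁ α⇐ ∘ (st X (W ⊗ Y) ∘ ((id ×₁ ev (F₀ (W ⊗ Y)) Y) ∘ α⇒))) ∘ (id ×₁ β W)) ≡ common
        rhs = begin
          Λ⁻¹ (Λ (F₁ α⇐ ∘ (st X (W ⊗ Y) ∘ ((id ×₁ ev (F₀ (W ⊗ Y)) Y) ∘ α⇒))) ∘ (id ×₁ β W))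
            ≡⟨ trans Λ⁻¹-∘ (Λ⁻¹-Λ ⟩∘⟨refl) ⟩
          (F₁ α⇐ ∘ (st _ _ ∘ ((id ×₁ ev _ _) ∘ α⇒))) ∘ ((id ×₁ β W) ×₁ id)
            ≡⟨ pullʳ (pullʳ (pullʳ α⇒∘×₁)) ⟩
          F₁ α⇐ ∘ (st _ _ ∘ ((id ×₁ ev _ _) ∘ ((id ×₁ (β W ×₁ id)) ∘ α⇒)))
            ≡⟨ refl⟩∘⟨ refl⟩∘⟨ pullˡ (trans id×₁∘id×₁ (cong (id ×₁_) Λ⁻¹-β)) ⟩
          F₁ α⇐ ∘ (st _ _ ∘ ((id ×₁ (F₁ (α♭ W) ∘ st′ _ _)) ∘ α⇒))
            ≡⟨ refl⟩∘⟨ refl⟩∘⟨ trans (sym id×₁∘id×₁ ⟩∘⟨refl) assoc ⟩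
          F₁ α⇐ ∘ (st _ _ ∘ ((id ×₁ F₁ (α♭ W)) ∘ ((id ×₁ st′ _ _) ∘ α⇒)))
            ≡⟨ trans (refl⟩∘⟨ extendʳ (sym st-natural₂)) F-mergeˡ ⟩
          common
            ∎

    β-morphism : IsStrongMonadMorphism C (TWriter C T M) (StateT C T Y) β
    β-morphism = record
      { natural = λ f → β-natural
      ; pres-η = λ X → β-η
      ; pres-μ = λ X → β-μ
      ; pres-st = λ X W → β-st
      }

  module LiftedQuery (P : ProductSituation C) where
    open ProductSituation P
    open Prop49Data C P
    open RightStrength T T-strong
    open WriterToState M Y α α-morphism using (α♭)
    open LiftedMorphism T T-strong M Y α α-morphism using (Λ⁻¹-β; F₁α♭∘st′∘st′×₁id)
    open LiftedAlgebras.WriterAlgebra T T-strong M τ×-alg using (lifted-action)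
    open RawStrongMonad T
    open IsStrongMonad T-strong
    open IsEMAlgebra τT-alg

    Λ⁻¹q∘τ××₁id : Λ⁻¹ q ∘ (τ× ×₁ id) ≡ Λ⁻¹ q ∘ α♭ Ω×
    Λ⁻¹q∘τ××₁id = begin
      Λ⁻¹ q ∘ (τ× ×₁ id)                                   ≡⟨ sym Λ⁻¹-∘ ⟩
      Λ⁻¹ (q ∘ τ×)                                          ≡⟨ cong Λ⁻¹ q-query ⟩
      Λ⁻¹ ((ev ΩT Y ^₁ Y) ∘ (((q ×₁ id) ^₁ Y) ∘ α Ω×))      ≡⟨ trans Λ⁻¹-^₁ (trans (refl⟩∘⟨ Λ⁻¹-^₁) (sym assoc)) ⟩
      Λ⁻¹ q ∘ α♭ Ω×                                         ∎

    Λ⁻¹-qT : Λ⁻¹ qT ≡ τT ∘ (F₁ (Λ⁻¹ q) ∘ st′ Ω× Y)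
    Λ⁻¹-qT = trans Λ⁻¹-^₁ (refl⟩∘⟨ Λ⁻¹-u∘F₁)

    F₁Λ⁻¹q∘st′∘lifted-action : F₁ (Λ⁻¹ q) ∘ (st′ Ω× Y ∘ (lifted-action ×₁ id)) ≡ F₁ (Λ⁻¹ q) ∘ (st′ Ω× Y ∘ α♭ (F₀ Ω×))
    F₁Λ⁻¹q∘st′∘lifted-action = begin
      F₁ (Λ⁻¹ q) ∘ (st′ _ _ ∘ (lifted-action ×₁ id))            ≡⟨ refl⟩∘⟨ trans (refl⟩∘⟨ sym ×₁id∘×₁id) (extendʳ (sym st′-natural)) ⟩
      F₁ (Λ⁻¹ q) ∘ (F₁ (τ× ×₁ id) ∘ (st′ _ _ ∘ (st′ _ _ ×₁ id))) ≡⟨ trans F-mergeˡ (cong F₁ Λ⁻¹q∘τ××₁id ⟩∘⟨refl) ⟩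
      F₁ (Λ⁻¹ q ∘ α♭ Ω×) ∘ (st′ _ _ ∘ (st′ _ _ ×₁ id))         ≡⟨ trans (F-∘ ⟩∘⟨refl) (pullʳ F₁α♭∘st′∘st′×₁id) ⟩
      F₁ (Λ⁻¹ q) ∘ (st′ _ _ ∘ α♭ (F₀ Ω×))                       ∎

    lifted-query : IsInferenceQuery C TW TS β (F₀ Ω×) τTW (ΩT ^ Y) τTS qT
    lifted-query = Λ⁻¹-injective (trans lhs (sym rhs))
      where
        common : Hom (F₀ (F₀ Ω× ⊗ Z) ⊗ Y) ΩT
        common = τT ∘ (F₁ (τT ∘ (F₁ (Λ⁻¹ q) ∘ (st′ Ω× Y ∘ α♭ (F₀ Ω×)))) ∘ st′ (F₀ Ω× ⊗ Z) Y)
        lhs : Λ⁻¹ (qT ∘ τTW) ≡ common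
        lhs = begin
          Λ⁻¹ (qT ∘ τTW)
            ≡⟨ trans Λ⁻¹-∘ (Λ⁻¹-qT ⟩∘⟨ trans (cong (_×₁ id) (refl⟩∘⟨ F-merge)) (sym ×₁id∘×₁id)) ⟩
          (τT ∘ (F₁ (Λ⁻¹ q) ∘ st′ _ _)) ∘ ((μ _ ×₁ id) ∘ (F₁ lifted-action ×₁ id))
            ≡⟨ pullʳ (pullʳ (pullˡ st′-μ)) ⟩
          τT ∘ (F₁ (Λ⁻¹ q) ∘ ((μ _ ∘ (F₁ (st′ _ _) ∘ st′ _ _)) ∘ (F₁ lifted-action ×₁ id)))
            ≡⟨ refl⟩∘⟨ refl⟩∘⟨ pullʳ (pullʳ (sym st′-natural)) ⟩
          τT ∘ (F₁ (Λ⁻¹ q) ∘ (μ _ ∘ (F₁ (st′ _ _) ∘ (F₁ (lifted-action ×₁ id) ∘ st′ _ _))))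
            ≡⟨ trans (refl⟩∘⟨ extendʳ (μ-natural _)) (extendʳ mult) ⟩
          τT ∘ (F₁ τT ∘ (F₁ (F₁ (Λ⁻¹ q)) ∘ (F₁ (st′ _ _) ∘ (F₁ (lifted-action ×₁ id) ∘ st′ _ _))))
            ≡⟨ refl⟩∘⟨ trans (refl⟩∘⟨ trans F-mergeˡ F-mergeˡ) F-mergeˡ ⟩
          τT ∘ (F₁ (τT ∘ ((F₁ (Λ⁻¹ q) ∘ st′ _ _) ∘ (lifted-action ×₁ id))) ∘ st′ _ _)
            ≡⟨ refl⟩∘⟨ cong F₁ (refl⟩∘⟨ trans assoc F₁Λ⁻¹q∘st′∘lifted-action) ⟩∘⟨refl ⟩
          common
            ∎
        rhs : Λ⁻¹ (τTS ∘ ((F₁ (qT ×₁ id) ^₁ Y) ∘ β (F₀ Ω×))) ≡ common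
        rhs = begin
          Λ⁻¹ (τTS ∘ ((F₁ (qT ×₁ id) ^₁ Y) ∘ β (F₀ Ω×)))
            ≡⟨ trans (cong Λ⁻¹ assoc) (trans Λ⁻¹-^₁ (refl⟩∘⟨ trans Λ⁻¹-^₁ (refl⟩∘⟨ trans Λ⁻¹-^₁ (refl⟩∘⟨ Λ⁻¹-β)))) ⟩
          τT ∘ (F₁ (ev _ _) ∘ (F₁ (qT ×₁ id) ∘ (F₁ (α♭ (F₀ Ω×)) ∘ st′ _ _)))
            ≡⟨ refl⟩∘⟨ trans F-mergeˡ F-mergeˡ ⟩
          τT ∘ (F₁ (Λ⁻¹ qT ∘ α♭ (F₀ Ω×)) ∘ st′ _ _)
            ≡⟨ refl⟩∘⟨ cong F₁ (trans (Λ⁻¹-qT ⟩∘⟨refl) (pullʳ assoc)) ⟩∘⟨refl ⟩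
          common
            ∎

proposition4p9 : ∀ {o ℓ : Level} (C : BiCCC o ℓ) (P : ProductSituation C) →
    let open BiCCC C
        open ProductSituation P
        open Prop49Data C P
    in IsStrongMonadMorphism C TW TS β
       × IsEMAlgebra C TW (T.F₀ Ω×) τTW
       × IsEMAlgebra C TS (ΩT ^ Y) τTS
       × IsInferenceQuery C TW TS β (T.F₀ Ω×) τTW (ΩT ^ Y) τTS qT
proposition4p9 C P =
    LiftedMorphism.β-morphism C T T-strong M Y α α-morphism
  , LiftedAlgebras.WriterAlgebra.TWriter-algebra C T T-strong M τ×-alg
  , LiftedAlgebras.StateAlgebra.StateT-algebra C T T-strong Y τT-alg
  , LiftedQuery.lifted-query C P
  where open ProductSituation P
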